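{- Let $G=(V,E)$ be a connected simple bridgeless triangle-free cubic graph and $\lambda$ a valid labeling of $\mathfrak{L}_2(G)$ such that no cycle in $\Gamma_\lambda$ has a self-intersection. Then for every $\gamma\in\Gamma_\lambda$ the projected closed walk $W(\gamma)$ in $G$ is a cycle.
   Context: Line graph $\mathcal{L}(H)$: vertex set $E(H)$, two edges adjacent iff they share exactly one endpoint. For each triangle $T$ of $\mathcal{L}(G)$ its three edges span a triangle in $\mathcal{L}(\mathcal{L}(G))$; $\mathfrak{L}_2(G)$ is $\mathcal{L}(\mathcal{L}(G))$ with all edges of all these triangles deleted. A vertex of $\mathfrak{L}_2(G)$ is an unordered pair $\{e,f\}$ of distinct edges of $G$ sharing an endpoint. Reduced cliques: for each $x\in E$ the four edges of $\mathcal{L}(G)$ incident to $x$ form a $K_4$ in $\mathcal{L}(\mathcal{L}(G))$; the reduced clique $\mathbb{X}_x$ is this $K_4$ minus the deleted edges. A labeling $\lambda:E(\mathfrak{L}_2(G))\to\{0,1\}$ (1 = open, 0 = closed) is valid if for every reduced clique $\mathbb{X}$ and every vertex $v$ of $\mathbb{X}$ there are vertices $w,u\neq v$ of $\mathbb{X}$ with $\langle v,w\rangle,\langle v,u\rangle\in E(\mathbb{X})$ and $\lambda_{\langle v,w\rangle}=1-\lambda_{\langle v,u\rangle}$. The open edges form a disjoint union of cycles, whose set is $\Gamma_\lambda$. A cycle $\gamma\in\Gamma_\lambda$ has a self-intersection if there is a reduced clique $\mathbb{X}$ such that both open edges of $\mathbb{X}$ belong to $\gamma$. Projection: if $\gamma$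 has cyclic vertex sequence $p_1,\dots,p_k$, consecutive vertices $p_{i-1},p_i$ share exactly one edge $x_i$ of $G$, and $W(\gamma)$ is the closed walk in $G$ with cyclic edge sequence $x_1,\dots,x_k$. -}

module Defs where

open import Data.Bool using (Bool; true; false; not; T; if_then_else_)
open import Data.Nat using (ℕ; zero; suc; _≤_)
open import Data.Nat.DivMod using (_mod_)
open import Data.Fin using (Fin; toℕ)
open import Data.List using (List; map; allFin)
open import Data.Nat.ListAction using (sum)
open import Data.Product using (Σ; Σ-syntax; _×_; _,_)
open import Data.Sum using (_⊎_)
open import Relation.Nullary using (¬_)
open import Relation.Binary.PropositionalEquality using (_≡_)
open import Relation.Binary.Construct.Closure.ReflexiveTransitive using (Star)

record Graph : Set₁ where
  field
    V   : Set
    _≈_ : V → V → Set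
    Adj : V → V → Set
open Graph public

-- An edge of H: an adjacent (ordered) pair, identified up to swapping.
record Edge (H : Graph) : Set where
  constructor ⟨_,_∣_⟩
  field
    src : V H
    tgt : V H
    adj : Adj H src tgt
open Edge public

_≈E_ : {H : Graph} → Edge H → Edge H → Set
_≈E_ {H} e f =
  (_≈_ H (src e) (src f) × _≈_ H (tgt e) (tgt f)) ⊎
  (_≈_ H (src e) (tgt f) × _≈_ H (tgt e) (src f))

_∈E_ : {H : Graph} → V H → Edge H → Set
_∈E_ {H} w e = _≈_ H w (src e) ⊎ _≈_ H w (tgt e)

ShareExactlyOne : {H : Graph} → Edge H → Edge H → Set
ShareExactlyOne {H} e f =
  Σ[ w ∈ V H ] (w ∈E e × w ∈E f × (∀ w' → w' ∈E e → w' ∈E f → _≈_ H w' w))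

LineGraph : Graph → Graph
LineGraph H = record
  { V   = Edge H
  ; _≈_ = _≈E_
  ; Adj = ShareExactlyOne
  }

SimpleGraph : ℕ → Set
SimpleGraph n = Fin n → Fin n → Bool

IsSimple : ∀ {n} → SimpleGraph n → Set
IsSimple {n} adj = (∀ u v → adj u v ≡ adj v u) × (∀ u → adj u u ≡ false)

toGraph : ∀ {n} → SimpleGraph n → Graph
toGraph {n} adj = record { V = Fin n ; _≈_ = _≡_ ; Adj = λ u v → T (adj u v) }

degree : ∀ {n} → SimpleGraph n → Fin n → ℕ
degree {n} adj v = sum (map (λ u → if adj v u then 1 else 0) (allFin n))

Cubic : ∀ {n} → SimpleGraph n → Set
Cubic {n} adj = ∀ v → degree adj v ≡ 3

TriangleFree : ∀ {n} → SimpleGraph n → Set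
TriangleFree {n} adj =
  ∀ a b c → T (adj a b) → T (adj b c) → T (adj a c) → Data.Empty.⊥
  where import Data.Empty

Connected : ∀ {n} → SimpleGraph n → Set
Connected {n} adj = ∀ u v → Star (λ x y → T (adj x y)) u v

Without : ∀ {n} → SimpleGraph n → Fin n → Fin n → Fin n → Fin n → Set
Without adj a b x y = T (adj x y) × ¬ ((x ≡ a × y ≡ b) ⊎ (x ≡ b × y ≡ a))

Bridgeless : ∀ {n} → SimpleGraph n → Set
Bridgeless {n} adj = ∀ a b → T (adj a b) → Star (Without adj a b) a b

module _ {n : ℕ} (G : SimpleGraph n) where

  LG : Graph
  LG = LineGraph (toGraph G)

  LLG : Graph
  LLG = LineGraph LG

  EG : Set
  EG = V LG

  -- vertices of 𝔏₂(G) = vertices of L(L(G)) (pairs {e,f} of edges sharing an endpoint)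
  V₂ : Set
  V₂ = V LLG

  _≈₂_ : V₂ → V₂ → Set
  _≈₂_ = _≈_ LLG

  record TriangleL : Set where
    field
      a b c : EG
      ab : Adj LG a b
      bc : Adj LG b c
      ac : Adj LG a c

  EdgeOfTri : TriangleL → V₂ → Set
  EdgeOfTri T p =
    p ≈₂ ⟨ a , b ∣ ab ⟩ ⊎ (p ≈₂ ⟨ b , c ∣ bc ⟩ ⊎ p ≈₂ ⟨ a , c ∣ ac ⟩)
    where open TriangleL T

  -- the L(L(G))-edge pq is an edge of some deleted triangle
  Deleted : V₂ → V₂ → Set
  Deleted p q = Σ[ T ∈ TriangleL ] (EdgeOfTri T p × EdgeOfTri T q)

  Adj₂ : V₂ → V₂ → Set
  Adj₂ p q = Adj LLG p q × ¬ Deleted p q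

  -- p is a vertex of the reduced clique 𝕏ₓ (p is an edge of L(G) incident to x)
  InX : EG → V₂ → Set
  InX x p = _∈E_ {LG} x p

  -- a labeling of the edges of 𝔏₂(G): given on adjacent pairs,
  -- required to be well defined on unordered pairs (true = open, false = closed)
  Labeling : Set
  Labeling = (p q : V₂) → Adj₂ p q → Bool

  WellDefined : Labeling → Set
  WellDefined lab = ∀ p q p' q' (h : Adj₂ p q) (h' : Adj₂ p' q') →
    ((p ≈₂ p' × q ≈₂ q') ⊎ (p ≈₂ q' × q ≈₂ p')) → lab p q h ≡ lab p' q' h'

  Valid : Labeling → Set
  Valid lab = ∀ (x : EG) (v : V₂) → InX x v →
    Σ[ w ∈ V₂ ] Σ[ u ∈ V₂ ] (InX x w × InX x u × ¬ (v ≈₂ w) × ¬ (v ≈₂ u) ×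
      Σ[ h₁ ∈ Adj₂ v w ] Σ[ h₂ ∈ Adj₂ v u ] (lab v w h₁ ≡ not (lab v u h₂)))

  Open : Labeling → V₂ → V₂ → Set
  Open lab p q = Σ[ h ∈ Adj₂ p q ] (lab p q h ≡ true)

csuc : ∀ {k} → Fin k → Fin k
csuc {suc m} i = suc (toℕ i) mod suc m

module _ {n : ℕ} (G : SimpleGraph n) (lab : Labeling G) where

  -- γ ∈ Γ_λ: a cycle (cyclic sequence of k ≥ 3 distinct vertices, consecutive
  -- ones joined by open edges) which is a whole connected component of the
  -- open subgraph (every open neighbour of a vertex of γ lies on γ)
  record InΓ (k : ℕ) (γ : Fin k → V₂ G) : Set where
    field
      length≥3  : 3 ≤ k
      distinct  : ∀ i j → _≈₂_ G (γ i) (γ j) → i ≡ j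
      openSteps : ∀ i → Open G lab (γ i) (γ (csuc i))
      closed    : ∀ i q → Open G lab (γ i) q → Σ[ j ∈ Fin k ] _≈₂_ G q (γ j)

  EdgeOfCycle : (k : ℕ) → (Fin k → V₂ G) → V₂ G → V₂ G → Set
  EdgeOfCycle k γ p q = Σ[ i ∈ Fin k ]
    ((_≈₂_ G p (γ i) × _≈₂_ G q (γ (csuc i))) ⊎
     (_≈₂_ G p (γ (csuc i)) × _≈₂_ G q (γ i)))

  SelfIntersection : (k : ℕ) → (Fin k → V₂ G) → Set
  SelfIntersection k γ = Σ[ x ∈ EG G ]
    (∀ p q (h : Adj₂ G p q) → InX G x p → InX G x q → lab p q h ≡ true →
       EdgeOfCycle k γ p q)

  IsProjection : (k : ℕ) → (Fin k → V₂ G) → (Fin k → EG G) → Set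
  IsProjection k γ x = ∀ i → InX G (x i) (γ i) × InX G (x i) (γ (csuc i))

IsCycleWalk : ∀ {n} (G : SimpleGraph n) (k : ℕ) → (Fin k → EG G) → Set
IsCycleWalk {n} G k x = Σ[ v ∈ (Fin k → Fin n) ]
  ((∀ i j → v i ≡ v j → i ≡ j) ×
   (∀ i → _∈E_ {toGraph G} (v i) (x i) × _∈E_ {toGraph G} (v (csuc i)) (x i)))

{-# OPTIONS --safe #-}
-- A vertex of 𝔏₂(G) is a path of length two in G, and W(γ) visits the centres of the
-- vertices of γ. If two vertices of γ had the same centre c, then, G being cubic, they
-- would share a leg g at c. The reduced clique 𝕏_g consists of the two paths through g
-- centred at c (here both on γ) and the two centred at the other end of g; its edges join
-- paths with different centres. Validity leaves every vertex exactly one open edge in each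
-- of its two reduced cliques, and γ is a whole component of the open subgraph, so both open
-- edges of 𝕏_g lie on γ: a self-intersection.
module Submission where

open import Defs
open import Data.Bool using (Bool; true; false; not; T; if_then_else_)
open import Data.Nat using (ℕ; zero; suc; _+_; _≤_; s≤s; _%_)
open import Data.Nat.Properties using (+-comm; +-assoc; ≤-reflexive; m≢1+n+m; m≤n⇒m<n∨m≡n)
open import Data.Nat.DivMod using (n%n≡0; m<n⇒m%n≡m)
open import Data.Nat.ListAction using (sum)
open import Data.Fin using (Fin; zero; suc; toℕ; fromℕ; inject₁)
open import Data.Fin.Properties using (_≟_; toℕ-injective; toℕ-fromℕ<; toℕ-fromℕ; toℕ-inject₁; toℕ<n)
open import Data.List using (tabulate)
open import Data.List.Properties using (map-tabulate)
open import Data.Product using (Σ-syntax; _×_; _,_; proj₁; proj₂)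
open import Data.Sum using (_⊎_; inj₁; inj₂)
open import Data.Empty using (⊥; ⊥-elim)
open import Function using (id)
open import Relation.Nullary using (¬_; yes; no; does)
open import Relation.Binary.PropositionalEquality

sumOf : ∀ {n} → (Fin n → ℕ) → ℕ
sumOf f = sum (tabulate f)

zeroAt : ∀ {n} → (Fin n → ℕ) → Fin n → Fin n → ℕ
zeroAt f a u = if does (u ≟ a) then 0 else f u

zeroAt-≢ : ∀ {n} (f : Fin n → ℕ) {a b : Fin n} → b ≢ a → zeroAt f a b ≡ f b
zeroAt-≢ f {a} {b} b≢a with b ≟ a
... | yes b≡a = ⊥-elim (b≢a b≡a)
... | no _ = refl

sumOf-zeroAt : ∀ {n} (f : Fin n → ℕ) (a : Fin n) → sumOf f ≡ f a + sumOf (zeroAt f a)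
sumOf-zeroAt {suc n} f zero = refl
sumOf-zeroAt {suc n} f (suc a) = begin
  f zero + sumOf (λ u → f (suc u))
    ≡⟨ cong (f zero +_) (sumOf-zeroAt (λ u → f (suc u)) a) ⟩
  f zero + (f (suc a) + rest)
    ≡⟨ sym (+-assoc (f zero) (f (suc a)) rest) ⟩
  (f zero + f (suc a)) + rest
    ≡⟨ cong (_+ rest) (+-comm (f zero) (f (suc a))) ⟩
  (f (suc a) + f zero) + rest
    ≡⟨ +-assoc (f (suc a)) (f zero) rest ⟩
  f (suc a) + (f zero + rest) ∎
  where
  open ≡-Reasoning
  rest = sumOf (zeroAt (λ u → f (suc u)) a)

sumOf-remove-one : ∀ {n} (f : Fin n → ℕ) {a : Fin n} → f a ≡ 1 → sumOf f ≡ suc (sumOf (zeroAt f a))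
sumOf-remove-one f {a} fa≡1 = trans (sumOf-zeroAt f a) (cong (_+ sumOf (zeroAt f a)) fa≡1)

if-T-then-1 : (b : Bool) → T b → (if b then 1 else 0) ≡ 1
if-T-then-1 true _ = refl

module _ {n : ℕ} (G : SimpleGraph n) (degree≤3 : ∀ v → degree G v ≤ 3) where

  no-four-neighbours : ∀ {c a b d e} → T (G c a) → T (G c b) → T (G c d) → T (G c e) →
    a ≢ b → a ≢ d → a ≢ e → b ≢ d → b ≢ e → d ≢ e → ⊥
  no-four-neighbours {c} {a} {b} {d} {e} ca cb cd ce a≢b a≢d a≢e b≢d b≢e d≢e
    with subst (_≤ 3) degree≡4+ (degree≤3 c)
    where
    f₀ f₁ f₂ f₃ : Fin n → ℕ
    f₀ u = if G c u then 1 else 0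
    f₁ = zeroAt f₀ a
    f₂ = zeroAt f₁ b
    f₃ = zeroAt f₂ d
    degree≡4+ : degree G c ≡ suc (suc (suc (suc (sumOf (zeroAt f₃ e)))))
    degree≡4+ = begin
      degree G c                                  ≡⟨ cong sum (map-tabulate id f₀) ⟩
      sumOf f₀                                    ≡⟨ sumOf-remove-one f₀ (if-T-then-1 _ ca) ⟩
      suc (sumOf f₁)                              ≡⟨ cong suc (sumOf-remove-one f₁ f₁b≡1) ⟩
      suc (suc (sumOf f₂))                        ≡⟨ cong (λ m → suc (suc m)) (sumOf-remove-one f₂ f₂d≡1) ⟩
      suc (suc (suc (sumOf f₃)))                  ≡⟨ cong (λ m → suc (suc (suc m))) (sumOf-remove-one f₃ f₃e≡1) ⟩
      suc (suc (suc (suc (sumOf (zeroAt f₃ e))))) ∎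
      where
      open ≡-Reasoning
      f₁b≡1 = trans (zeroAt-≢ f₀ (≢-sym a≢b)) (if-T-then-1 _ cb)
      f₂d≡1 = trans (zeroAt-≢ f₁ (≢-sym b≢d)) (trans (zeroAt-≢ f₀ (≢-sym a≢d)) (if-T-then-1 _ cd))
      f₃e≡1 = trans (zeroAt-≢ f₂ (≢-sym d≢e)) (trans (zeroAt-≢ f₁ (≢-sym b≢e))
                (trans (zeroAt-≢ f₀ (≢-sym a≢e)) (if-T-then-1 _ ce)))
  ... | s≤s (s≤s (s≤s ()))

  neighbour-among : ∀ {c a b d e} → T (G c a) → T (G c b) → T (G c d) → a ≢ b → a ≢ d → b ≢ d →
    T (G c e) → e ≡ a ⊎ e ≡ b ⊎ e ≡ d
  neighbour-among {a = a} {b} {d} {e} ca cb cd a≢b a≢d b≢d ce with e ≟ a | e ≟ b | e ≟ d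
  ... | yes e≡a | _       | _       = inj₁ e≡a
  ... | no _    | yes e≡b | _       = inj₂ (inj₁ e≡b)
  ... | no _    | no _    | yes e≡d = inj₂ (inj₂ e≡d)
  ... | no e≢a  | no e≢b  | no e≢d  =
    ⊥-elim (no-four-neighbours ca cb cd ce a≢b a≢d (≢-sym e≢a) b≢d (≢-sym e≢b) (≢-sym e≢d))

cpred : ∀ {k} → Fin k → Fin k
cpred {suc m} zero = fromℕ m
cpred {suc m} (suc i) = inject₁ i

toℕ-csuc : ∀ {m} (i : Fin (suc m)) → toℕ (csuc i) ≡ suc (toℕ i) % suc m
toℕ-csuc i = toℕ-fromℕ< _

csuc-cpred : ∀ {k} (i : Fin k) → csuc (cpred i) ≡ i
csuc-cpred {suc m} zero = toℕ-injective (begin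
  toℕ (csuc (fromℕ m))        ≡⟨ toℕ-csuc (fromℕ m) ⟩
  suc (toℕ (fromℕ m)) % suc m ≡⟨ cong (λ j → suc j % suc m) (toℕ-fromℕ m) ⟩
  suc m % suc m               ≡⟨ n%n≡0 (suc m) ⟩
  0                           ∎)
  where open ≡-Reasoning
csuc-cpred {suc m} (suc i) = toℕ-injective (begin
  toℕ (csuc (inject₁ i))        ≡⟨ toℕ-csuc (inject₁ i) ⟩
  suc (toℕ (inject₁ i)) % suc m ≡⟨ cong (λ j → suc j % suc m) (toℕ-inject₁ i) ⟩
  suc (toℕ i) % suc m           ≡⟨ m<n⇒m%n≡m (toℕ<n (suc i)) ⟩
  suc (toℕ i)                   ∎)
  where open ≡-Reasoning

cpred≢csuc : ∀ {k} → 3 ≤ k → (i : Fin k) → cpred i ≢ csuc i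
cpred≢csuc {suc zero} (s≤s ()) zero
cpred≢csuc {suc (suc zero)} (s≤s (s≤s ())) zero
cpred≢csuc {suc (suc (suc m))} _ zero eq
  with trans (sym (toℕ-fromℕ (suc (suc m)))) (trans (cong toℕ eq) (toℕ-csuc {suc (suc m)} zero))
... | ()
cpred≢csuc {suc m} 3≤k (suc i) eq with m≤n⇒m<n∨m≡n (toℕ<n (suc i))
... | inj₁ 2+i<k = m≢1+n+m (toℕ i) (begin
  toℕ i                     ≡⟨ sym (toℕ-inject₁ i) ⟩
  toℕ (inject₁ i)           ≡⟨ cong toℕ eq ⟩
  toℕ (csuc (suc i))        ≡⟨ toℕ-csuc (suc i) ⟩
  suc (suc (toℕ i)) % suc m ≡⟨ m<n⇒m%n≡m 2+i<k ⟩
  suc (suc (toℕ i))         ∎)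
  where open ≡-Reasoning
... | inj₂ 2+i≡k = k≢2 3≤k (begin
  suc m             ≡⟨ sym 2+i≡k ⟩
  suc (suc (toℕ i)) ≡⟨ cong (λ j → suc (suc j)) i≡0 ⟩
  2                 ∎)
  where
  open ≡-Reasoning
  i≡0 : toℕ i ≡ 0
  i≡0 = begin
    toℕ i                     ≡⟨ sym (toℕ-inject₁ i) ⟩
    toℕ (inject₁ i)           ≡⟨ cong toℕ eq ⟩
    toℕ (csuc (suc i))        ≡⟨ toℕ-csuc (suc i) ⟩
    suc (suc (toℕ i)) % suc m ≡⟨ cong (_% suc m) 2+i≡k ⟩
    suc m % suc m             ≡⟨ n%n≡0 (suc m) ⟩
    0                         ∎
  k≢2 : ∀ {k} → 3 ≤ k → k ≢ 2
  k≢2 (s≤s (s≤s (s≤s _))) ()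

module EdgeGeometry {n : ℕ} (G : SimpleGraph n) (simple : IsSimple G) where

  E : Set
  E = EG G

  _≈e_ : E → E → Set
  _≈e_ = _≈E_ {toGraph G}

  _∈e_ : Fin n → E → Set
  _∈e_ = _∈E_ {toGraph G}

  _≋_ : V₂ G → V₂ G → Set
  _≋_ = _≈₂_ G

  X : E → V₂ G → Set
  X = InX G

  adjacent-sym : ∀ {a b} → T (G a b) → T (G b a)
  adjacent-sym {a} {b} = subst T (proj₁ simple a b)

  adjacent-irrefl : ∀ {a} → ¬ T (G a a)
  adjacent-irrefl {a} = subst T (proj₂ simple a)

  other : (e : E) (w : Fin n) → w ∈e e → Fin n
  other e w (inj₁ _) = tgt e
  other e w (inj₂ _) = src e

  other∈ : (e : E) (w : Fin n) (w∈e : w ∈e e) → other e w w∈e ∈e e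
  other∈ e w (inj₁ _) = inj₂ refl
  other∈ e w (inj₂ _) = inj₁ refl

  adjacent-other : (e : E) (w : Fin n) (w∈e : w ∈e e) → T (G w (other e w w∈e))
  adjacent-other e w (inj₁ refl) = adj e
  adjacent-other e w (inj₂ refl) = adjacent-sym (adj e)

  other≢ : (e : E) (w : Fin n) (w∈e : w ∈e e) → other e w w∈e ≢ w
  other≢ e w w∈e eq = adjacent-irrefl (subst (λ z → T (G w z)) eq (adjacent-other e w w∈e))

  ∈-cases : (e : E) {x w : Fin n} → x ∈e e → (w∈e : w ∈e e) → x ≡ w ⊎ x ≡ other e w w∈e
  ∈-cases e (inj₁ x≡s) (inj₁ w≡s) = inj₁ (trans x≡s (sym w≡s))
  ∈-cases e (inj₂ x≡t) (inj₁ w≡s) = inj₂ x≡t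
  ∈-cases e (inj₁ x≡s) (inj₂ w≡t) = inj₂ x≡s
  ∈-cases e (inj₂ x≡t) (inj₂ w≡t) = inj₁ (trans x≡t (sym w≡t))

  ≈e-refl : (e : E) → e ≈e e
  ≈e-refl e = inj₁ (refl , refl)

  ≈e-sym : (e f : E) → e ≈e f → f ≈e e
  ≈e-sym e f (inj₁ (ss , tt)) = inj₁ (sym ss , sym tt)
  ≈e-sym e f (inj₂ (st , ts)) = inj₂ (sym ts , sym st)

  ≈e-trans : (e f g : E) → e ≈e f → f ≈e g → e ≈e g
  ≈e-trans e f g (inj₁ (a , b)) (inj₁ (c , d)) = inj₁ (trans a c , trans b d)
  ≈e-trans e f g (inj₁ (a , b)) (inj₂ (c , d)) = inj₂ (trans a c , trans b d)
  ≈e-trans e f g (inj₂ (a , b)) (inj₁ (c , d)) = inj₂ (trans a d , trans b c)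
  ≈e-trans e f g (inj₂ (a , b)) (inj₂ (c , d)) = inj₁ (trans a d , trans b c)

  ∈-resp-≈e : {x : Fin n} (e f : E) → x ∈e e → e ≈e f → x ∈e f
  ∈-resp-≈e e f (inj₁ x≡s) (inj₁ (a , _)) = inj₁ (trans x≡s a)
  ∈-resp-≈e e f (inj₂ x≡t) (inj₁ (_ , b)) = inj₂ (trans x≡t b)
  ∈-resp-≈e e f (inj₁ x≡s) (inj₂ (a , _)) = inj₂ (trans x≡s a)
  ∈-resp-≈e e f (inj₂ x≡t) (inj₂ (_ , b)) = inj₁ (trans x≡t b)

  ≈e-from-endpoints : {x y : Fin n} (e f : E) → x ∈e e → y ∈e e → x ∈e f → y ∈e f → x ≢ y → e ≈e f
  ≈e-from-endpoints {x} {y} e f xe ye xf yf x≢y with orient e xe ye | orient f xf yf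
    where
    orient : (h : E) → x ∈e h → y ∈e h → (x ≡ src h × y ≡ tgt h) ⊎ (x ≡ tgt h × y ≡ src h)
    orient h (inj₁ xs) (inj₁ ys) = ⊥-elim (x≢y (trans xs (sym ys)))
    orient h (inj₁ xs) (inj₂ yt) = inj₁ (xs , yt)
    orient h (inj₂ xt) (inj₁ ys) = inj₂ (xt , ys)
    orient h (inj₂ xt) (inj₂ yt) = ⊥-elim (x≢y (trans xt (sym yt)))
  ... | inj₁ (a , b) | inj₁ (c , d) = inj₁ (trans (sym a) c , trans (sym b) d)
  ... | inj₁ (a , b) | inj₂ (c , d) = inj₂ (trans (sym a) c , trans (sym b) d)
  ... | inj₂ (a , b) | inj₁ (c , d) = inj₂ (trans (sym b) d , trans (sym a) c)
  ... | inj₂ (a , b) | inj₂ (c , d) = inj₁ (trans (sym b) d , trans (sym a) c)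

  ≈e-from-other : {c c' : Fin n} (e f : E) (ce : c ∈e e) (c'f : c' ∈e f) → c ≡ c' →
    other e c ce ≡ other f c' c'f → e ≈e f
  ≈e-from-other e f ce c'f refl same-other = ≈e-from-endpoints e f ce (other∈ e _ ce) c'f
    (subst (_∈e f) (sym same-other) (other∈ f _ c'f)) (≢-sym (other≢ e _ ce))

  shareExactlyOne⇒≉ : (e f : E) → ShareExactlyOne {toGraph G} e f → ¬ e ≈e f
  shareExactlyOne⇒≉ e f (w , we , wf , only-w) e≈f =
    other≢ e w we (only-w (other e w we) (other∈ e w we) (∈-resp-≈e e f (other∈ e w we) e≈f))

  shareExactlyOne-intro : {c : Fin n} (e f : E) → c ∈e e → c ∈e f → ¬ e ≈e f → ShareExactlyOne {toGraph G} e f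
  shareExactlyOne-intro {c} e f ce cf e≉f = c , ce , cf , only-c
    where
    only-c : ∀ w → w ∈e e → w ∈e f → w ≡ c
    only-c w we wf with w ≟ c
    ... | yes w≡c = w≡c
    ... | no w≢c = ⊥-elim (e≉f (≈e-from-endpoints e f we ce wf cf w≢c))

  centre : V₂ G → Fin n
  centre r = proj₁ (adj r)

  centre∈src : (r : V₂ G) → centre r ∈e src r
  centre∈src r = proj₁ (proj₂ (adj r))

  centre∈tgt : (r : V₂ G) → centre r ∈e tgt r
  centre∈tgt r = proj₁ (proj₂ (proj₂ (adj r)))

  centre-unique : (r : V₂ G) (w : Fin n) → w ∈e src r → w ∈e tgt r → w ≡ centre r
  centre-unique r = proj₂ (proj₂ (proj₂ (adj r)))

  src≉tgt : (r : V₂ G) → ¬ src r ≈e tgt r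
  src≉tgt r = shareExactlyOne⇒≉ (src r) (tgt r) (adj r)

  ≋-refl : (r : V₂ G) → r ≋ r
  ≋-refl r = inj₁ (≈e-refl (src r) , ≈e-refl (tgt r))

  ≋-sym : (r s : V₂ G) → r ≋ s → s ≋ r
  ≋-sym r s (inj₁ (a , b)) = inj₁ (≈e-sym (src r) (src s) a , ≈e-sym (tgt r) (tgt s) b)
  ≋-sym r s (inj₂ (a , b)) = inj₂ (≈e-sym (tgt r) (src s) b , ≈e-sym (src r) (tgt s) a)

  ≋-trans : (r s t : V₂ G) → r ≋ s → s ≋ t → r ≋ t
  ≋-trans r s t (inj₁ (a , b)) (inj₁ (c , d)) =
    inj₁ (≈e-trans (src r) (src s) (src t) a c , ≈e-trans (tgt r) (tgt s) (tgt t) b d)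
  ≋-trans r s t (inj₁ (a , b)) (inj₂ (c , d)) =
    inj₂ (≈e-trans (src r) (src s) (tgt t) a c , ≈e-trans (tgt r) (tgt s) (src t) b d)
  ≋-trans r s t (inj₂ (a , b)) (inj₁ (c , d)) =
    inj₂ (≈e-trans (src r) (tgt s) (tgt t) a d , ≈e-trans (tgt r) (src s) (src t) b c)
  ≋-trans r s t (inj₂ (a , b)) (inj₂ (c , d)) =
    inj₁ (≈e-trans (src r) (tgt s) (src t) a d , ≈e-trans (tgt r) (src s) (tgt t) b c)

  centre-resp-≋ : (r s : V₂ G) → r ≋ s → centre r ≡ centre s
  centre-resp-≋ r s (inj₁ (a , b)) = centre-unique s (centre r)
    (∈-resp-≈e (src r) (src s) (centre∈src r) a) (∈-resp-≈e (tgt r) (tgt s) (centre∈tgt r) b)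
  centre-resp-≋ r s (inj₂ (a , b)) = centre-unique s (centre r)
    (∈-resp-≈e (tgt r) (src s) (centre∈tgt r) b) (∈-resp-≈e (src r) (tgt s) (centre∈src r) a)

  X-resp-≋ : (e : E) (r s : V₂ G) → X e r → r ≋ s → X e s
  X-resp-≋ e r s (inj₁ e≈s) (inj₁ (a , _)) = inj₁ (≈e-trans e (src r) (src s) e≈s a)
  X-resp-≋ e r s (inj₂ e≈t) (inj₁ (_ , b)) = inj₂ (≈e-trans e (tgt r) (tgt s) e≈t b)
  X-resp-≋ e r s (inj₁ e≈s) (inj₂ (a , _)) = inj₂ (≈e-trans e (src r) (tgt s) e≈s a)
  X-resp-≋ e r s (inj₂ e≈t) (inj₂ (_ , b)) = inj₁ (≈e-trans e (tgt r) (src s) e≈t b)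

  X-resp-≈e : (e f : E) (r : V₂ G) → e ≈e f → X e r → X f r
  X-resp-≈e e f r e≈f (inj₁ e≈s) = inj₁ (≈e-trans f e (src r) (≈e-sym e f e≈f) e≈s)
  X-resp-≈e e f r e≈f (inj₂ e≈t) = inj₂ (≈e-trans f e (tgt r) (≈e-sym e f e≈f) e≈t)

  centre∈ : (e : E) (r : V₂ G) → X e r → centre r ∈e e
  centre∈ e r (inj₁ e≈s) = ∈-resp-≈e (src r) e (centre∈src r) (≈e-sym e (src r) e≈s)
  centre∈ e r (inj₂ e≈t) = ∈-resp-≈e (tgt r) e (centre∈tgt r) (≈e-sym e (tgt r) e≈t)

  leg otherLeg : (r : V₂ G) (e : E) → X e r → E
  leg r e (inj₁ _) = src r
  leg r e (inj₂ _) = tgt r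
  otherLeg r e (inj₁ _) = tgt r
  otherLeg r e (inj₂ _) = src r

  leg≈ : (r : V₂ G) (e : E) (er : X e r) → leg r e er ≈e e
  leg≈ r e (inj₁ e≈s) = ≈e-sym e (src r) e≈s
  leg≈ r e (inj₂ e≈t) = ≈e-sym e (tgt r) e≈t

  X-otherLeg : (r : V₂ G) (e : E) (er : X e r) → X (otherLeg r e er) r
  X-otherLeg r e (inj₁ _) = inj₂ (≈e-refl (tgt r))
  X-otherLeg r e (inj₂ _) = inj₁ (≈e-refl (src r))

  centre∈otherLeg : (r : V₂ G) (e : E) (er : X e r) → centre r ∈e otherLeg r e er
  centre∈otherLeg r e (inj₁ _) = centre∈tgt r
  centre∈otherLeg r e (inj₂ _) = centre∈src r

  otherLeg≉ : (r : V₂ G) (e : E) (er : X e r) → ¬ otherLeg r e er ≈e e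
  otherLeg≉ r e (inj₁ e≈s) t≈e = src≉tgt r (≈e-sym (tgt r) (src r) (≈e-trans (tgt r) e (src r) t≈e e≈s))
  otherLeg≉ r e (inj₂ e≈t) s≈e = src≉tgt r (≈e-trans (src r) e (tgt r) s≈e e≈t)

  ≋-from-legs : (r s : V₂ G) (e f : E) (er : X e r) (fs : X f s) →
    leg r e er ≈e leg s f fs → otherLeg r e er ≈e otherLeg s f fs → r ≋ s
  ≋-from-legs r s e f (inj₁ _) (inj₁ _) l≈l o≈o = inj₁ (l≈l , o≈o)
  ≋-from-legs r s e f (inj₁ _) (inj₂ _) l≈l o≈o = inj₂ (l≈l , o≈o)
  ≋-from-legs r s e f (inj₂ _) (inj₁ _) l≈l o≈o = inj₂ (o≈o , l≈l)
  ≋-from-legs r s e f (inj₂ _) (inj₂ _) l≈l o≈o = inj₁ (o≈o , l≈l)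

  farEnd : (r : V₂ G) (e : E) → X e r → Fin n
  farEnd r e er = other (otherLeg r e er) (centre r) (centre∈otherLeg r e er)

  adjacent-farEnd : (r : V₂ G) (e : E) (er : X e r) → T (G (centre r) (farEnd r e er))
  adjacent-farEnd r e er = adjacent-other (otherLeg r e er) (centre r) (centre∈otherLeg r e er)

  farEnd∉ : (r : V₂ G) (e : E) (er : X e r) {x : Fin n} → x ∈e e → x ≢ centre r → farEnd r e er ≢ x
  farEnd∉ r e er x∈e x≢c far≡x = otherLeg≉ r e er (≈e-from-endpoints (otherLeg r e er) e
    (centre∈otherLeg r e er) (subst (_∈e otherLeg r e er) far≡x (other∈ _ (centre r) (centre∈otherLeg r e er)))
    (centre∈ e r er) x∈e (≢-sym x≢c))

  ≋-from-farEnd : (r s : V₂ G) (e : E) (er : X e r) (es : X e s) → centre r ≡ centre s →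
    farEnd r e er ≡ farEnd s e es → r ≋ s
  ≋-from-farEnd r s e er es same-centre same-far = ≋-from-legs r s e e er es
    (≈e-trans (leg r e er) e (leg s e es) (leg≈ r e er) (≈e-sym (leg s e es) e (leg≈ s e es)))
    (≈e-from-other (otherLeg r e er) (otherLeg s e es) (centre∈otherLeg r e er) (centre∈otherLeg s e es)
      same-centre same-far)

  neighbour-contains-leg : (r s : V₂ G) (g : E) (gr : X g r) → Adj₂ G r s → X g s ⊎ X (otherLeg r g gr) s
  neighbour-contains-leg r s g gr ((w , wr , ws , _) , _) = cases gr wr
    where
    cases : (gr : X g r) → X w r → X g s ⊎ X (otherLeg r g gr) s
    cases (inj₁ g≈s) (inj₁ w≈s) = inj₁ (X-resp-≈e w g s (≈e-trans w (src r) g w≈s (≈e-sym g (src r) g≈s)) ws)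
    cases (inj₁ _)   (inj₂ w≈t) = inj₂ (X-resp-≈e w (tgt r) s w≈t ws)
    cases (inj₂ _)   (inj₁ w≈s) = inj₂ (X-resp-≈e w (src r) s w≈s ws)
    cases (inj₂ g≈t) (inj₂ w≈t) = inj₁ (X-resp-≈e w g s (≈e-trans w (tgt r) g w≈t (≈e-sym g (tgt r) g≈t)) ws)

  Adj₂-sym : (r s : V₂ G) → Adj₂ G r s → Adj₂ G s r
  Adj₂-sym r s ((w , wr , ws , only-w) , not-deleted) =
    (w , ws , wr , λ w' w's w'r → only-w w' w'r w's) , λ { (t , tr , ts) → not-deleted (t , ts , tr) }

  -- Otherwise the three legs of r and s at the common centre span a triangle of L(G)
  -- having r and s among its sides, so the edge rs of L(L(G)) is deleted.
  Adj₂⇒centre≢ : (r s : V₂ G) → Adj₂ G r s → centre r ≢ centre s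
  Adj₂⇒centre≢ r s ((w , wr , ws , only-w) , not-deleted) same-centre =
    not-deleted (triangle , inj₁ (≋-refl r) , s-side wr)
    where
    h : E
    h = otherLeg s w ws
    c∈h : centre r ∈e h
    c∈h = subst (_∈e h) (sym same-centre) (centre∈otherLeg s w ws)
    leg-of-r≉h : (l : E) → X l r → ¬ l ≈e h
    leg-of-r≉h l lr l≈h = otherLeg≉ s w ws (≈e-trans h l w (≈e-sym l h l≈h)
      (only-w l lr (X-resp-≈e h l s (≈e-sym l h l≈h) (X-otherLeg s w ws))))
    triangle : TriangleL G
    triangle = record
      { a = src r ; b = tgt r ; c = h ; ab = adj r
      ; bc = shareExactlyOne-intro (tgt r) h (centre∈tgt r) c∈h (leg-of-r≉h (tgt r) (inj₂ (≈e-refl (tgt r))))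
      ; ac = shareExactlyOne-intro (src r) h (centre∈src r) c∈h (leg-of-r≉h (src r) (inj₁ (≈e-refl (src r)))) }
    s-side : X w r → EdgeOfTri G triangle s
    s-side (inj₁ w≈s) = inj₂ (inj₂ (≋-from-legs s ⟨ src r , h ∣ TriangleL.ac triangle ⟩ w w ws (inj₁ w≈s)
      (≈e-trans (leg s w ws) w (src r) (leg≈ s w ws) w≈s) (≈e-refl h)))
    s-side (inj₂ w≈t) = inj₂ (inj₁ (≋-from-legs s ⟨ tgt r , h ∣ TriangleL.bc triangle ⟩ w w ws (inj₁ w≈t)
      (≈e-trans (leg s w ws) w (tgt r) (leg≈ s w ws) w≈t) (≈e-refl h)))

  Adj₂-centre-other : (e : E) (r s : V₂ G) → X e r → X e s → Adj₂ G r s →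
    {d : Fin n} (de : d ∈e e) → centre r ≡ d → centre s ≡ other e d de
  Adj₂-centre-other e r s er es rs de cr≡d with ∈-cases e (centre∈ e s es) de
  ... | inj₁ cs≡d = ⊥-elim (Adj₂⇒centre≢ r s rs (trans cr≡d (sym cs≡d)))
  ... | inj₂ cs≡other = cs≡other

  module _ (degree≤3 : ∀ v → degree G v ≤ 3) where

    ≋-one-of-two : (g : E) {c : Fin n} (cg : c ∈e g) (w u s : V₂ G) (gw : X g w) (gu : X g u) (gs : X g s) →
      centre w ≡ c → centre u ≡ c → centre s ≡ c → ¬ w ≋ u → s ≋ w ⊎ s ≋ u
    ≋-one-of-two g {c} cg w u s gw gu gs wc uc sc w≉u
      with neighbour-among G degree≤3 (adjacent-other g c cg) (far-adjacent w gw wc) (far-adjacent u gu uc)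
             (≢-sym (far≢other w gw wc)) (≢-sym (far≢other u gu uc)) far-w≢far-u (far-adjacent s gs sc)
      where
      far-adjacent : (r : V₂ G) (gr : X g r) → centre r ≡ c → T (G c (farEnd r g gr))
      far-adjacent r gr rc = subst (λ z → T (G z (farEnd r g gr))) rc (adjacent-farEnd r g gr)
      far≢other : (r : V₂ G) (gr : X g r) → centre r ≡ c → farEnd r g gr ≢ other g c cg
      far≢other r gr rc = farEnd∉ r g gr (other∈ g c cg) (λ o≡cr → other≢ g c cg (trans o≡cr rc))
      far-w≢far-u : farEnd w g gw ≢ farEnd u g gu
      far-w≢far-u same-far = w≉u (≋-from-farEnd w u g gw gu (trans wc (sym uc)) same-far)
    ... | inj₁ far-s≡other = ⊥-elim (farEnd∉ s g gs (other∈ g c cg)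
            (λ o≡cs → other≢ g c cg (trans o≡cs sc)) far-s≡other)
    ... | inj₂ (inj₁ same-far) = inj₁ (≋-from-farEnd s w g gs gw (trans sc (sym wc)) same-far)
    ... | inj₂ (inj₂ same-far) = inj₂ (≋-from-farEnd s u g gs gu (trans sc (sym uc)) same-far)

    same-centre⇒shared-leg : (r r' : V₂ G) → centre r ≡ centre r' → Σ[ g ∈ E ] (X g r × X g r')
    same-centre⇒shared-leg r r' same with srcEnd r' ≟ srcEnd r | srcEnd r' ≟ tgtEnd r
      where
      srcEnd tgtEnd : V₂ G → Fin n
      srcEnd r = other (src r) (centre r) (centre∈src r)
      tgtEnd r = other (tgt r) (centre r) (centre∈tgt r)
    ... | yes s'≡s | _ = src r , inj₁ (≈e-refl (src r)) ,
      inj₁ (≈e-from-other (src r) (src r') (centre∈src r) (centre∈src r') same (sym s'≡s))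
    ... | no _ | yes s'≡t = tgt r , inj₂ (≈e-refl (tgt r)) ,
      inj₁ (≈e-from-other (tgt r) (src r') (centre∈tgt r) (centre∈src r') same (sym s'≡t))
    ... | no s'≢s | no s'≢t
      with neighbour-among G degree≤3
             (adjacent-other (src r) (centre r) (centre∈src r)) (adjacent-other (tgt r) (centre r) (centre∈tgt r))
             (at-centre-r (adjacent-other (src r') (centre r') (centre∈src r'))) s≢t (≢-sym s'≢s) (≢-sym s'≢t)
             (at-centre-r (adjacent-other (tgt r') (centre r') (centre∈tgt r')))
      where
      at-centre-r : ∀ {a} → T (G (centre r') a) → T (G (centre r) a)
      at-centre-r {a} = subst (λ z → T (G z a)) (sym same)
      s≢t : other (src r) (centre r) (centre∈src r) ≢ other (tgt r) (centre r) (centre∈tgt r)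
      s≢t same-end = src≉tgt r (≈e-from-other (src r) (tgt r) (centre∈src r) (centre∈tgt r) refl same-end)
    ...   | inj₁ t'≡s = src r , inj₁ (≈e-refl (src r)) ,
      inj₂ (≈e-from-other (src r) (tgt r') (centre∈src r) (centre∈tgt r') same (sym t'≡s))
    ...   | inj₂ (inj₁ t'≡t) = tgt r , inj₂ (≈e-refl (tgt r)) ,
      inj₂ (≈e-from-other (tgt r) (tgt r') (centre∈tgt r) (centre∈tgt r') same (sym t'≡t))
    ...   | inj₂ (inj₂ t'≡s') = ⊥-elim (src≉tgt r'
      (≈e-from-other (src r') (tgt r') (centre∈src r') (centre∈tgt r') refl (sym t'≡s')))

module Labelled {n : ℕ} (G : SimpleGraph n) (simple : IsSimple G) (degree≤3 : ∀ v → degree G v ≤ 3)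
  (lab : Labeling G) (well-defined : WellDefined G lab) (valid : Valid G lab) where

  open EdgeGeometry G simple

  lab-resp-≋ : {p p' q q' : V₂ G} (pq : Adj₂ G p q) (p'q' : Adj₂ G p' q') → p ≋ p' → q ≋ q' →
    lab p q pq ≡ lab p' q' p'q'
  lab-resp-≋ {p} {p'} {q} {q'} pq p'q' p≋p' q≋q' = well-defined p q p' q' pq p'q' (inj₁ (p≋p' , q≋q'))

  Open-sym : (p q : V₂ G) → Open G lab p q → Open G lab q p
  Open-sym p q (pq , pq-open) = Adj₂-sym p q pq ,
    trans (well-defined q p p q (Adj₂-sym p q pq) pq (inj₂ (≋-refl q , ≋-refl p))) pq-open

  -- Validity gives p two neighbours w, u in 𝕏ₑ with different labels, and every neighbour
  -- of p in 𝕏ₑ is one of them (≋-one-of-two), so p has only one open neighbour there.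
  open-neighbour-unique : (e : E) {p p' q q' : V₂ G} → p ≋ p' → X e p →
    Open G lab p q → Open G lab p' q' → X e q → X e q' → q ≋ q'
  open-neighbour-unique e {p} {p'} {q} {q'} p≋p' ep (pq , pq-open) (p'q' , p'q'-open) eq eq'
    with valid e p ep
  ... | w , u , ew , eu , _ , _ , pw , pu , labels-differ =
    compare (classify p q eq pq (≋-refl p)) (classify p' q' eq' p'q' p≋p')
    where
    cp = centre∈ e p ep

    w≉u : ¬ w ≋ u
    w≉u w≋u = b≢not-b (trans (sym (lab-resp-≋ pw pu (≋-refl p) w≋u)) labels-differ)
      where
      b≢not-b : ∀ {b} → b ≢ not b
      b≢not-b {true} ()
      b≢not-b {false} ()

    centre-of-neighbour : (p₀ s : V₂ G) → X e s → Adj₂ G p₀ s → p ≋ p₀ → centre s ≡ other e (centre p) cp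
    centre-of-neighbour p₀ s es p₀s p≋p₀ =
      Adj₂-centre-other e p₀ s (X-resp-≋ e p p₀ ep p≋p₀) es p₀s cp (sym (centre-resp-≋ p p₀ p≋p₀))

    classify : (p₀ s : V₂ G) → X e s → Adj₂ G p₀ s → p ≋ p₀ → s ≋ w ⊎ s ≋ u
    classify p₀ s es p₀s p≋p₀ = ≋-one-of-two degree≤3 e (other∈ e (centre p) cp) w u s ew eu es
      (centre-of-neighbour p w ew pw (≋-refl p)) (centre-of-neighbour p u eu pu (≋-refl p))
      (centre-of-neighbour p₀ s es p₀s p≋p₀) w≉u

    not-both-open : lab p w pw ≡ true → lab p u pu ≡ true → ⊥
    not-both-open w-open u-open with trans (sym w-open) (trans labels-differ (cong not u-open))
    ... | ()

    w-open : q ≋ w → lab p w pw ≡ true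
    w-open q≋w = trans (lab-resp-≋ pw pq (≋-refl p) (≋-sym q w q≋w)) pq-open
    u-open : q ≋ u → lab p u pu ≡ true
    u-open q≋u = trans (lab-resp-≋ pu pq (≋-refl p) (≋-sym q u q≋u)) pq-open
    w-open' : q' ≋ w → lab p w pw ≡ true
    w-open' q'≋w = trans (lab-resp-≋ pw p'q' p≋p' (≋-sym q' w q'≋w)) p'q'-open
    u-open' : q' ≋ u → lab p u pu ≡ true
    u-open' q'≋u = trans (lab-resp-≋ pu p'q' p≋p' (≋-sym q' u q'≋u)) p'q'-open

    compare : q ≋ w ⊎ q ≋ u → q' ≋ w ⊎ q' ≋ u → q ≋ q'
    compare (inj₁ q≋w) (inj₁ q'≋w) = ≋-trans q w q' q≋w (≋-sym q' w q'≋w)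
    compare (inj₂ q≋u) (inj₂ q'≋u) = ≋-trans q u q' q≋u (≋-sym q' u q'≋u)
    compare (inj₁ q≋w) (inj₂ q'≋u) = ⊥-elim (not-both-open (w-open q≋w) (u-open' q'≋u))
    compare (inj₂ q≋u) (inj₁ q'≋w) = ⊥-elim (not-both-open (w-open' q'≋w) (u-open q≋u))

  module OnCycle (k : ℕ) (γ : Fin k → V₂ G) (γ∈Γ : InΓ G lab k γ) where

    open InΓ γ∈Γ

    open-to-pred : (m : Fin k) → Open G lab (γ m) (γ (cpred m))
    open-to-pred m = Open-sym (γ (cpred m)) (γ m)
      (subst (λ j → Open G lab (γ (cpred m)) (γ j)) (csuc-cpred m) (openSteps (cpred m)))

    EdgeOfCycle-sym : (p q : V₂ G) → EdgeOfCycle G lab k γ q p → EdgeOfCycle G lab k γ p q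
    EdgeOfCycle-sym p q (i , inj₁ (q≋ , p≋)) = i , inj₂ (p≋ , q≋)
    EdgeOfCycle-sym p q (i , inj₂ (q≋ , p≋)) = i , inj₁ (p≋ , q≋)

    -- γ m has at most one open neighbour in each of its two reduced cliques; if neither cycle
    -- neighbour lay in 𝕏_g, both would be that neighbour in the other clique, forcing
    -- cpred m ≡ csuc m.
    open-edge-in-clique-on-cycle : (g : E) (m : Fin k) (p q : V₂ G) → p ≋ γ m → X g (γ m) →
      Open G lab p q → X g q → EdgeOfCycle G lab k γ p q
    open-edge-in-clique-on-cycle g m p q p≋γm gγm pq gq
      with neighbour-contains-leg (γ m) (γ (csuc m)) g gγm (proj₁ (openSteps m))
    ... | inj₁ g-next = m , inj₁ (p≋γm , ≋-sym (γ (csuc m)) q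
      (open-neighbour-unique g γm≋p gγm (openSteps m) pq g-next gq))
      where γm≋p = ≋-sym p (γ m) p≋γm
    ... | inj₂ g'-next with neighbour-contains-leg (γ m) (γ (cpred m)) g gγm (proj₁ (open-to-pred m))
    ...   | inj₁ g-prev = cpred m ,
      inj₂ (subst (λ j → p ≋ γ j) (sym (csuc-cpred m)) p≋γm , ≋-sym (γ (cpred m)) q
        (open-neighbour-unique g γm≋p gγm (open-to-pred m) pq g-prev gq))
      where γm≋p = ≋-sym p (γ m) p≋γm
    ...   | inj₂ g'-prev = ⊥-elim (cpred≢csuc length≥3 m (sym (distinct (csuc m) (cpred m)
      (open-neighbour-unique (otherLeg (γ m) g gγm) (≋-refl (γ m)) (X-otherLeg (γ m) g gγm)
        (openSteps m) (open-to-pred m) g'-next g'-prev))))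

    open-edge-at-repeated-centre : (g : E) (i j : Fin k) → i ≢ j → X g (γ i) → X g (γ j) →
      centre (γ i) ≡ centre (γ j) → (p q : V₂ G) → X g p → centre p ≡ centre (γ i) →
      Open G lab p q → X g q → EdgeOfCycle G lab k γ p q
    open-edge-at-repeated-centre g i j i≢j gi gj same p q gp cp pq gq
      with ≋-one-of-two degree≤3 g (centre∈ g (γ i) gi) (γ i) (γ j) p gi gj gp refl (sym same) cp
             (λ γi≋γj → i≢j (distinct i j γi≋γj))
    ... | inj₁ p≋γi = open-edge-in-clique-on-cycle g i p q p≋γi gi pq gq
    ... | inj₂ p≋γj = open-edge-in-clique-on-cycle g j p q p≋γj gj pq gq

    -- Every vertex of 𝕏_g is centred at an end of g and adjacent vertices have different
    -- centres, so one end of each open edge of 𝕏_g is centred at centre (γ i).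
    repeated-centre⇒self-intersection : (i j : Fin k) → i ≢ j → centre (γ i) ≡ centre (γ j) →
      SelfIntersection G lab k γ
    repeated-centre⇒self-intersection i j i≢j same with same-centre⇒shared-leg degree≤3 (γ i) (γ j) same
    ... | g , gi , gj = g , on-cycle
      where
      cg = centre∈ g (γ i) gi
      on-cycle : ∀ p q (pq : Adj₂ G p q) → X g p → X g q → lab p q pq ≡ true → EdgeOfCycle G lab k γ p q
      on-cycle p q pq gp gq pq-open with ∈-cases g (centre∈ g p gp) cg | ∈-cases g (centre∈ g q gq) cg
      ... | inj₁ cp | _ = open-edge-at-repeated-centre g i j i≢j gi gj same p q gp cp (pq , pq-open) gq
      ... | inj₂ _ | inj₁ cq = EdgeOfCycle-sym p q
        (open-edge-at-repeated-centre g i j i≢j gi gj same q p gq cq (Open-sym p q (pq , pq-open)) gp)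
      ... | inj₂ cp | inj₂ cq = ⊥-elim (Adj₂⇒centre≢ p q pq (trans cp (sym cq)))

lemma2p16 : ∀ {n} (G : SimpleGraph n) → IsSimple G → Connected G → Bridgeless G →
    TriangleFree G → Cubic G →
    (lab : Labeling G) → WellDefined G lab → Valid G lab →
    (∀ k (γ : Fin k → V₂ G) → InΓ G lab k γ → ¬ SelfIntersection G lab k γ) →
    ∀ k (γ : Fin k → V₂ G) → InΓ G lab k γ →
    (x : Fin k → EG G) → IsProjection G lab k γ x → IsCycleWalk G k x
lemma2p16 G simple _ _ _ cubic lab well-defined valid no-self-intersection k γ γ∈Γ x projection =
  vertex , vertex-injective , vertex∈x
  where
  open EdgeGeometry G simple
  open Labelled G simple (λ v → ≤-reflexive (cubic v)) lab well-defined valid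
  open OnCycle k γ γ∈Γ

  vertex : Fin k → Fin _
  vertex i = centre (γ i)

  vertex∈x : ∀ i → vertex i ∈e x i × vertex (csuc i) ∈e x i
  vertex∈x i = centre∈ (x i) (γ i) (proj₁ (projection i)) , centre∈ (x i) (γ (csuc i)) (proj₂ (projection i))

  vertex-injective : ∀ i j → vertex i ≡ vertex j → i ≡ j
  vertex-injective i j same with i ≟ j
  ... | yes i≡j = i≡j
  ... | no i≢j = ⊥-elim (no-self-intersection k γ γ∈Γ (repeated-centre⇒self-intersection i j i≢j same))
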